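{- Let $G$ be a connected graph with $n$ vertices and radius $r$. In the cop versus gambler game on $G$ against the $1$-observed gambler, the cop has a Watch-Move-Wait strategy $\mathrm{WMW}_1$ (for a suitable choice of initial vertex) such that, for every probability distribution $p_1,\dots,p_n$ the gambler may choose, the expected capture time is at most $n+r$.
   Context: Cop versus gambler game: played on a connected graph $G$ with vertices $v_1,\dots,v_n$. First the cop chooses an initial vertex; then the gambler chooses a probability distribution $p_1,\dots,p_n$ on the vertices (possibly depending on the cop's initial vertex). The game proceeds in turns $1,2,\dots$; in each turn the cop moves to an adjacent vertex or stays put, and simultaneously the gambler appears at vertex $v_i$ with probability $p_i$, independently of all other turns. The gambler is caught at the first turn in which the cop occupies the vertex at which the gambler appears; the capture time is the number of that turn. The $t$-observed gambler: the cop does not know the distribution, and the gambler is invisible during the game, but before the game starts the cop observes the gambler's positions in $t$ pre-game turns (i.e. $t$ independent draws from the distribution), during which the cop stays at the initial vertex and cannot catch the gambler; moreover, in turn $1$ of the game the cop must stay at the initial vertex. The strategy $\mathrm{WMW}_1$: the cop makes the single pre-game observation, then moves (along a shortest path) from the initial vertex to the vertex at which the gambler was observed, and waits there until the gambler is caught.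
   Formalization: The gambler's probability distribution $p_1,\dots,p_n$ has rational entries. -}

module Defs where

open import Data.Nat using (ℕ; zero; suc)
import Data.Nat as ℕ
open import Data.Fin using (Fin)
import Data.Fin as Fin
open import Data.Integer using (+_)
open import Data.Rational using (ℚ; 0ℚ; 1ℚ; _+_; _*_; _-_; _≤_; _/_)
open import Data.Product using (Σ; ∃; ∃-syntax; _×_; _,_)
open import Relation.Nullary using (¬_)
open import Relation.Binary.PropositionalEquality using (_≡_)

record Graph (n : ℕ) : Set₁ where
  field
    Adj    : Fin n → Fin n → Set
    sym    : ∀ {u v} → Adj u v → Adj v u
    irrefl : ∀ {u} → ¬ Adj u u

module _ {n : ℕ} (G : Graph n) where
  open Graph G

  data Walk : Fin n → Fin n → ℕ → Set where
    []  : ∀ {u} → Walk u u 0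
    _∷_ : ∀ {u w v d} → Adj u w → Walk w v d → Walk u v (suc d)

  walkAt : ∀ {u v d} → Walk u v d → ℕ → Fin n
  walkAt {u} []      _       = u
  walkAt {u} (_ ∷ _) zero    = u
  walkAt     (_ ∷ w) (suc i) = walkAt w i

  Connected : Set
  Connected = ∀ u v → ∃[ d ] Walk u v d

  IsDist : Fin n → Fin n → ℕ → Set
  IsDist u v d = Walk u v d × (∀ {d'} → Walk u v d' → d ℕ.≤ d')

  IsRadius : ℕ → Set
  IsRadius r =
    (∃[ c ] ∀ v → ∃[ d ] (IsDist c v d × d ℕ.≤ r)) ×
    (∀ c → ∃[ v ] ∃[ d ] (IsDist c v d × r ℕ.≤ d))

  -- A WMW₁ strategy from initial vertex c: for every possible observed vertex v,
  -- a fixed shortest path from c to v.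
  record WMW₁ (c : Fin n) : Set where
    field
      len      : Fin n → ℕ
      path     : (v : Fin n) → Walk c v (len v)
      shortest : ∀ v {d'} → Walk c v d' → len v ℕ.≤ d'

sumFin : ∀ {n} → (Fin n → ℚ) → ℚ
sumFin {zero}  f = 0ℚ
sumFin {suc n} f = f Fin.zero + sumFin (λ i → f (Fin.suc i))

sumTo : ℕ → (ℕ → ℚ) → ℚ
sumTo zero    f = f 0
sumTo (suc K) f = sumTo K f + f (suc K)

ℕtoℚ : ℕ → ℚ
ℕtoℚ m = (+ m) / 1

IsDistribution : ∀ {n} → (Fin n → ℚ) → Set
IsDistribution p = (∀ i → 0ℚ ≤ p i) × (sumFin p ≡ 1ℚ)

module _ {n : ℕ} (G : Graph n) where

  -- P(T > k) when the cop follows walk w (turn j, j ≥ 1, at walkAt w (j - 1)):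
  -- ∏_{j=1}^{k} (1 - p(position at turn j))
  survival : (Fin n → ℚ) → ∀ {u v d} → Walk G u v d → ℕ → ℚ
  survival p w zero    = 1ℚ
  survival p w (suc k) = survival p w k * (1ℚ - p (walkAt G w k))

  -- Partial sum Σ_{k=0}^{K} P(T > k) of E[T] = Σ_{k ≥ 0} P(T > k) for strategy WMW₁,
  -- averaging over the pre-game observation v (probability p v).
  expectedCapturePartial : ∀ {c} → WMW₁ G c → (Fin n → ℚ) → ℕ → ℚ
  expectedCapturePartial σ p K =
    sumFin (λ v → p v * sumTo K (survival p (WMW₁.path σ v)))

{-# OPTIONS --safe #-}
-- Let the cop start at a centre c and, after observing the gambler at v, walk a
-- shortest path (length d ≤ r) to v and wait there. Write q = p v, x k for the
-- gambler's probability at the cop's position in turn k + 1, and s k = ∏_{j<k} (1 - x j)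
-- for the probability of surviving k turns. The potential q (s 0 + ⋯ + s (m-1)) + s m
-- starts at 1 and grows by s m (q - x m) ≤ q per turn, and not at all once the cop
-- waits at v, where x m = q. Hence q E[T | v] ≤ 1 + q d ≤ 1 + q r, and averaging
-- over v gives E[T] ≤ n + r.
module Submission where

open import Defs
open import Data.Fin using (Fin)
import Data.Fin as Fin
import Data.Nat as ℕ
import Data.Nat.Properties as ℕ
open import Data.Product using (∃; ∃-syntax; _,_; proj₁; proj₂; map₂)
open import Function using (_∘_)
open import Data.Sum using (inj₁; inj₂)
open import Relation.Binary.PropositionalEquality using (_≡_; refl; sym; trans; cong; cong₂; subst; module ≡-Reasoning)

-- ℚ arithmetic is opened only inside this anonymous module, so that _+_ in
-- mainTheorem1 below is addition on ℕ.
module _ where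
  open import Data.Nat using (ℕ; zero; suc)
  import Data.Integer as ℤ
  import Data.Integer.Properties as ℤ
  open import Data.Nat.Coprimality using (1-coprimeTo) renaming (sym to coprime-sym)
  open import Data.Rational using (ℚ; 0ℚ; 1ℚ; _≤_; _+_; _*_; _-_; -_; nonNegative)
  open import Data.Rational.Literals using (fromℤ)
  open import Data.Rational.Properties
  import Data.Rational.Unnormalised as ℚᵘ
  import Data.Rational.Unnormalised.Properties as ℚᵘ
  open import Data.Rational.Solver using (module +-*-Solver)
  open +-*-Solver using (solve; _:=_; _:+_; _:*_; _:-_; con)

  ℕtoℚ≡fromℤ : ∀ m → ℕtoℚ m ≡ fromℤ (ℤ.+ m)
  ℕtoℚ≡fromℤ m = normalize-coprime (coprime-sym (1-coprimeTo m))

  ℕtoℚ-+ : ∀ m n → ℕtoℚ (m ℕ.+ n) ≡ ℕtoℚ m + ℕtoℚ n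
  ℕtoℚ-+ m n rewrite ℕtoℚ≡fromℤ m | ℕtoℚ≡fromℤ n | ℕtoℚ≡fromℤ (m ℕ.+ n) =
    toℚᵘ-injective (ℚᵘ.≃-sym (ℚᵘ.≃-trans (toℚᵘ-homo-+ (fromℤ (ℤ.+ m)) (fromℤ (ℤ.+ n))) (ℚᵘ.*≡* numerators)))
    where
    numerators : (ℤ.+ m ℤ.* ℤ.+ 1 ℤ.+ ℤ.+ n ℤ.* ℤ.+ 1) ℤ.* ℤ.+ 1 ≡ ℤ.+ (m ℕ.+ n) ℤ.* ℤ.+ 1
    numerators = cong (ℤ._* ℤ.+ 1) (trans (cong₂ ℤ._+_ (ℤ.*-identityʳ (ℤ.+ m)) (ℤ.*-identityʳ (ℤ.+ n))) (sym (ℤ.pos-+ m n)))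

  ℕtoℚ-suc : ∀ m → ℕtoℚ (suc m) ≡ 1ℚ + ℕtoℚ m
  ℕtoℚ-suc = ℕtoℚ-+ 1

  ℕtoℚ-nonNeg : ∀ m → 0ℚ ≤ ℕtoℚ m
  ℕtoℚ-nonNeg m = nonNegative⁻¹ (ℕtoℚ m) {{normalize-nonNeg m 1}}

  0≤p*q : ∀ {p q} → 0ℚ ≤ p → 0ℚ ≤ q → 0ℚ ≤ p * q
  0≤p*q {p} {q} 0≤p 0≤q = ≤-trans (≤-reflexive (sym (*-zeroʳ p))) (*-monoˡ-≤-nonNeg p {{nonNegative 0≤p}} 0≤q)

  p≤q⇒0≤q-p : ∀ {p q} → p ≤ q → 0ℚ ≤ q - p
  p≤q⇒0≤q-p {p} p≤q = ≤-trans (≤-reflexive (sym (+-inverseʳ p))) (+-monoˡ-≤ (- p) p≤q)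

  0≤q⇒p-q≤p : ∀ {p q} → 0ℚ ≤ q → p - q ≤ p
  0≤q⇒p-q≤p {p} 0≤q = ≤-trans (+-monoʳ-≤ p (neg-antimono-≤ 0≤q)) (≤-reflexive (+-identityʳ p))

  p≤1⇒p*q≤q : ∀ {p q} → p ≤ 1ℚ → 0ℚ ≤ q → p * q ≤ q
  p≤1⇒p*q≤q {q = q} p≤1 0≤q = ≤-trans (*-monoʳ-≤-nonNeg q {{nonNegative 0≤q}} p≤1) (≤-reflexive (*-identityˡ q))

  ℕtoℚ-mono-≤ : ∀ {m n} → m ℕ.≤ n → ℕtoℚ m ≤ ℕtoℚ n
  ℕtoℚ-mono-≤ {m} m≤n with ℕ.m≤n⇒∃[o]m+o≡n m≤n
  ... | o , refl = begin
    ℕtoℚ m              ≡⟨ +-identityʳ (ℕtoℚ m) ⟨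
    ℕtoℚ m + 0ℚ         ≤⟨ +-monoʳ-≤ (ℕtoℚ m) (ℕtoℚ-nonNeg o) ⟩
    ℕtoℚ m + ℕtoℚ o     ≡⟨ ℕtoℚ-+ m o ⟨
    ℕtoℚ (m ℕ.+ o)      ∎
    where open ≤-Reasoning

  sumFin-mono-≤ : ∀ {m} {f g : Fin m → ℚ} → (∀ i → f i ≤ g i) → sumFin f ≤ sumFin g
  sumFin-mono-≤ {zero}  f≤g = ≤-refl
  sumFin-mono-≤ {suc m} f≤g = +-mono-≤ (f≤g Fin.zero) (sumFin-mono-≤ (f≤g ∘ Fin.suc))

  sumFin-nonNeg : ∀ {m} {f : Fin m → ℚ} → (∀ i → 0ℚ ≤ f i) → 0ℚ ≤ sumFin f
  sumFin-nonNeg {zero}  0≤f = ≤-refl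
  sumFin-nonNeg {suc m} 0≤f = +-mono-≤ (0≤f Fin.zero) (sumFin-nonNeg (0≤f ∘ Fin.suc))

  ≤-sumFin : ∀ {m} {f : Fin m → ℚ} → (∀ i → 0ℚ ≤ f i) → ∀ i → f i ≤ sumFin f
  ≤-sumFin {suc m} {f} 0≤f Fin.zero = begin
    f Fin.zero                          ≡⟨ +-identityʳ (f Fin.zero) ⟨
    f Fin.zero + 0ℚ                     ≤⟨ +-monoʳ-≤ (f Fin.zero) (sumFin-nonNeg (0≤f ∘ Fin.suc)) ⟩
    sumFin f                            ∎
    where open ≤-Reasoning
  ≤-sumFin {suc m} {f} 0≤f (Fin.suc i) = begin
    f (Fin.suc i)                       ≡⟨ +-identityˡ (f (Fin.suc i)) ⟨
    0ℚ + f (Fin.suc i)                  ≤⟨ +-mono-≤ (0≤f Fin.zero) (≤-sumFin (0≤f ∘ Fin.suc) i) ⟩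
    sumFin f                            ∎
    where open ≤-Reasoning

  sumFin-+ : ∀ {m} (f g : Fin m → ℚ) → sumFin (λ i → f i + g i) ≡ sumFin f + sumFin g
  sumFin-+ {zero}  f g = refl
  sumFin-+ {suc m} f g = trans (cong ((f Fin.zero + g Fin.zero) +_) (sumFin-+ (f ∘ Fin.suc) (g ∘ Fin.suc)))
    (solve 4 (λ a b c d → (a :+ b) :+ (c :+ d) := (a :+ c) :+ (b :+ d)) refl
      (f Fin.zero) (g Fin.zero) (sumFin (f ∘ Fin.suc)) (sumFin (g ∘ Fin.suc)))

  sumFin-*ʳ : ∀ {m} (f : Fin m → ℚ) a → sumFin (λ i → f i * a) ≡ sumFin f * a
  sumFin-*ʳ {zero}  f a = sym (*-zeroˡ a)
  sumFin-*ʳ {suc m} f a = trans (cong ((f Fin.zero * a) +_) (sumFin-*ʳ (f ∘ Fin.suc) a))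
    (sym (*-distribʳ-+ a (f Fin.zero) (sumFin (f ∘ Fin.suc))))

  sumFin-1 : ∀ m → sumFin {m} (λ _ → 1ℚ) ≡ ℕtoℚ m
  sumFin-1 zero    = refl
  sumFin-1 (suc m) = trans (cong (1ℚ +_) (sumFin-1 m)) (sym (ℕtoℚ-suc m))

  distribution-≤1 : ∀ {m} {p : Fin m → ℚ} → IsDistribution p → ∀ i → p i ≤ 1ℚ
  distribution-≤1 (0≤p , sum≡1) i = subst (_ ≤_) sum≡1 (≤-sumFin 0≤p i)

  sumBelow : ℕ → (ℕ → ℚ) → ℚ
  sumBelow zero    f = 0ℚ
  sumBelow (suc m) f = sumBelow m f + f m

  sumTo≡sumBelow : ∀ K f → sumTo K f ≡ sumBelow (suc K) f
  sumTo≡sumBelow zero    f = sym (+-identityˡ (f 0))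
  sumTo≡sumBelow (suc K) f = cong (_+ f (suc K)) (sumTo≡sumBelow K f)

  module SurvivalProduct
    (x : ℕ → ℚ) (0≤x : ∀ k → 0ℚ ≤ x k) (x≤1 : ∀ k → x k ≤ 1ℚ)
    (s : ℕ → ℚ) (s-zero : s 0 ≡ 1ℚ) (s-suc : ∀ k → s (suc k) ≡ s k * (1ℚ - x k))
    where

    s-nonNeg : ∀ k → 0ℚ ≤ s k
    s-nonNeg zero    = subst (0ℚ ≤_) (sym s-zero) (nonNegative⁻¹ 1ℚ)
    s-nonNeg (suc k) = subst (0ℚ ≤_) (sym (s-suc k)) (0≤p*q (s-nonNeg k) (p≤q⇒0≤q-p (x≤1 k)))

    s≤1 : ∀ k → s k ≤ 1ℚ
    s≤1 zero    = ≤-reflexive s-zero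
    s≤1 (suc k) = begin
      s (suc k)          ≡⟨ s-suc k ⟩
      s k * (1ℚ - x k)   ≤⟨ *-monoˡ-≤-nonNeg (s k) {{nonNegative (s-nonNeg k)}} (0≤q⇒p-q≤p (0≤x k)) ⟩
      s k * 1ℚ           ≡⟨ *-identityʳ (s k) ⟩
      s k                ≤⟨ s≤1 k ⟩
      1ℚ                 ∎
      where open ≤-Reasoning

    module _ (q : ℚ) (0≤q : 0ℚ ≤ q) (d : ℕ) (x-eventually : ∀ k → d ℕ.≤ k → x k ≡ q) where

      potential : ℕ → ℚ
      potential m = q * sumBelow m s + s m

      potential-suc : ∀ m → potential (suc m) ≡ potential m + s m * (q - x m)
      potential-suc m = trans (cong (q * sumBelow (suc m) s +_) (s-suc m))
        (solve 4 (λ q S s x → q :* (S :+ s) :+ s :* (con 1ℚ :- x) := (q :* S :+ s) :+ s :* (q :- x)) refl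
          q (sumBelow m s) (s m) (x m))

      increment≤q : ∀ m → s m * (q - x m) ≤ q
      increment≤q m = begin
        s m * (q - x m)   ≤⟨ *-monoˡ-≤-nonNeg (s m) {{nonNegative (s-nonNeg m)}} (0≤q⇒p-q≤p (0≤x m)) ⟩
        s m * q           ≤⟨ p≤1⇒p*q≤q (s≤1 m) 0≤q ⟩
        q                 ∎
        where open ≤-Reasoning

      potential≤ : ∀ m → potential m ≤ 1ℚ + q * ℕtoℚ m
      potential≤ zero = ≤-reflexive (trans (cong (q * 0ℚ +_) s-zero) (+-comm (q * 0ℚ) 1ℚ))
      potential≤ (suc m) = begin
        potential (suc m)                   ≡⟨ potential-suc m ⟩
        potential m + s m * (q - x m)       ≤⟨ +-mono-≤ (potential≤ m) (increment≤q m) ⟩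
        1ℚ + q * ℕtoℚ m + q                 ≡⟨ solve 2 (λ q k → con 1ℚ :+ q :* k :+ q := con 1ℚ :+ q :* (con 1ℚ :+ k)) refl q (ℕtoℚ m) ⟩
        1ℚ + q * (1ℚ + ℕtoℚ m)              ≡⟨ cong (λ k → 1ℚ + q * k) (ℕtoℚ-suc m) ⟨
        1ℚ + q * ℕtoℚ (suc m)               ∎
        where open ≤-Reasoning

      potential-stable : ∀ j → potential (d ℕ.+ j) ≡ potential d
      potential-stable zero    = cong potential (ℕ.+-identityʳ d)
      potential-stable (suc j) = begin
        potential (d ℕ.+ suc j)         ≡⟨ cong potential (ℕ.+-suc d j) ⟩
        potential (suc k)               ≡⟨ potential-suc k ⟩
        potential k + s k * (q - x k)   ≡⟨ cong (λ y → potential k + s k * (q - y)) (x-eventually k (ℕ.m≤m+n d j)) ⟩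
        potential k + s k * (q - q)     ≡⟨ solve 3 (λ φ s q → φ :+ s :* (q :- q) := φ) refl (potential k) (s k) q ⟩
        potential k                     ≡⟨ potential-stable j ⟩
        potential d                     ∎
        where
        k : ℕ
        k = d ℕ.+ j
        open ≡-Reasoning

      potential≤1+q*d : ∀ m → potential m ≤ 1ℚ + q * ℕtoℚ d
      potential≤1+q*d m with ℕ.≤-total m d
      ... | inj₁ m≤d = ≤-trans (potential≤ m) (+-monoʳ-≤ 1ℚ (*-monoˡ-≤-nonNeg q {{nonNegative 0≤q}} (ℕtoℚ-mono-≤ m≤d)))
      ... | inj₂ d≤m with ℕ.m≤n⇒∃[o]m+o≡n d≤m
      ...   | j , refl = ≤-trans (≤-reflexive (potential-stable j)) (potential≤ d)

      q*sumTo≤1+q*d : ∀ K → q * sumTo K s ≤ 1ℚ + q * ℕtoℚ d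
      q*sumTo≤1+q*d K = begin
        q * sumTo K s                           ≡⟨ cong (q *_) (sumTo≡sumBelow K s) ⟩
        q * sumBelow (suc K) s                  ≡⟨ +-identityʳ _ ⟨
        q * sumBelow (suc K) s + 0ℚ             ≤⟨ +-monoʳ-≤ (q * sumBelow (suc K) s) (s-nonNeg (suc K)) ⟩
        potential (suc K)                       ≤⟨ potential≤1+q*d (suc K) ⟩
        1ℚ + q * ℕtoℚ d                         ∎
        where open ≤-Reasoning

  module _ {n : ℕ} (G : Graph n) where

    walkAt-end : ∀ {u v d} (w : Walk G u v d) m → d ℕ.≤ m → walkAt G w m ≡ v
    walkAt-end []      m       _           = refl
    walkAt-end (_ ∷ w) (suc m) (ℕ.s≤s d≤m) = walkAt-end w m d≤m

    observed-capture≤ : (p : Fin n → ℚ) → IsDistribution p → ∀ {c v d} (w : Walk G c v d) K →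
                        p v * sumTo K (survival G p w) ≤ 1ℚ + p v * ℕtoℚ d
    observed-capture≤ p p-dist@(0≤p , _) {v = v} {d} w =
      SurvivalProduct.q*sumTo≤1+q*d
        (p ∘ walkAt G w) (0≤p ∘ walkAt G w) (distribution-≤1 p-dist ∘ walkAt G w)
        (survival G p w) refl (λ _ → refl)
        (p v) (0≤p v) d (λ k d≤k → cong p (walkAt-end w k d≤k))

    shortestPathStrategy : ∀ {c} → (∀ v → ∃[ d ] IsDist G c v d) → WMW₁ G c
    shortestPathStrategy dist = record
      { len      = proj₁ ∘ dist
      ; path     = λ v → proj₁ (proj₂ (dist v))
      ; shortest = λ v → proj₂ (proj₂ (dist v))
      }

    wmw₁-expectedCapture≤ : ∀ {c} (σ : WMW₁ G c) e → (∀ v → WMW₁.len σ v ℕ.≤ e) →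
                            (p : Fin n → ℚ) → IsDistribution p →
                            ∀ K → expectedCapturePartial G σ p K ≤ ℕtoℚ (n ℕ.+ e)
    wmw₁-expectedCapture≤ σ e len≤e p p-dist@(0≤p , sum≡1) K = begin
      expectedCapturePartial G σ p K                        ≤⟨ sumFin-mono-≤ per-vertex ⟩
      sumFin (λ v → 1ℚ + p v * ℕtoℚ e)                     ≡⟨ sumFin-+ (λ _ → 1ℚ) (λ v → p v * ℕtoℚ e) ⟩
      sumFin {n} (λ _ → 1ℚ) + sumFin (λ v → p v * ℕtoℚ e)   ≡⟨ cong₂ _+_ (sumFin-1 n) (sumFin-*ʳ p (ℕtoℚ e)) ⟩
      ℕtoℚ n + sumFin p * ℕtoℚ e                            ≡⟨ cong (λ t → ℕtoℚ n + t * ℕtoℚ e) sum≡1 ⟩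
      ℕtoℚ n + 1ℚ * ℕtoℚ e                                  ≡⟨ cong (ℕtoℚ n +_) (*-identityˡ (ℕtoℚ e)) ⟩
      ℕtoℚ n + ℕtoℚ e                                       ≡⟨ ℕtoℚ-+ n e ⟨
      ℕtoℚ (n ℕ.+ e)                                        ∎
      where
      open ≤-Reasoning
      per-vertex : ∀ v → p v * sumTo K (survival G p (WMW₁.path σ v)) ≤ 1ℚ + p v * ℕtoℚ e
      per-vertex v = ≤-trans (observed-capture≤ p p-dist (WMW₁.path σ v) K)
        (+-monoʳ-≤ 1ℚ (*-monoˡ-≤-nonNeg (p v) {{nonNegative (0≤p v)}} (ℕtoℚ-mono-≤ (len≤e v))))

open import Data.Nat using (ℕ; _+_)
open import Data.Rational using (ℚ; _≤_)

mainTheorem1 : ∀ {n : ℕ} (G : Graph n) (r : ℕ) → Connected G → IsRadius G r →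
    ∃[ c ] ∃ λ (σ : WMW₁ G c) → ((p : Fin n → ℚ) → IsDistribution p →
      ∀ K → expectedCapturePartial G {c} σ p K ≤ ℕtoℚ (n + r))
mainTheorem1 G r _ ((c , ecc) , _) = c , σ , wmw₁-expectedCapture≤ G σ r (proj₂ ∘ proj₂ ∘ ecc)
  where
  σ : WMW₁ G c
  σ = shortestPathStrategy G (map₂ proj₁ ∘ ecc)
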